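{- Let $n\ge3$ and let $x$ be a vertex of the Möbius ladder $M_{2n}$ to which a label $\ell\in[1,\lceil n/2\rceil]$ is assigned. Then for every vertex $v$ covered by $x$ there exists a vertex $u$, also covered by $x$, such that $d(u,v)=2$.
   Context: For $n\ge2$, the Möbius ladder $M_{2n}$ has vertex set $\{x_1,\dots,x_{2n}\}$ and edge set $\{\{x_i,x_{i+1}\}:1\le i\le 2n\}\cup\{\{x_i,x_{i+n}\}:1\le i\le n\}$, subscripts taken modulo $2n$. $d$ denotes graph distance and $[a,b]=\{a,a+1,\dots,b\}$. A vertex carrying a positive integer label $\ell$ covers exactly the vertices at distance $\ell$ from it. -}

module Defs where

open import Data.Nat using (ℕ; zero; suc; _+_; _<_)
open import Data.Fin using (Fin; toℕ)
open import Data.Sum using (_⊎_)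
open import Data.Product using (_×_)
open import Relation.Binary.PropositionalEquality using (_≡_)
open import Relation.Nullary using (¬_)

-- Vertices of M_{2n}: Fin (n + n); vertex k (0-based) stands for x_{k+1}.

RimStep : (n : ℕ) → Fin (n + n) → Fin (n + n) → Set
RimStep n i j = (toℕ j ≡ suc (toℕ i)) ⊎ ((suc (toℕ i) ≡ n + n) × (toℕ j ≡ 0))

RungStep : (n : ℕ) → Fin (n + n) → Fin (n + n) → Set
RungStep n i j = toℕ j ≡ toℕ i + n

Adj : (n : ℕ) → Fin (n + n) → Fin (n + n) → Set
Adj n i j = (RimStep n i j ⊎ RimStep n j i) ⊎ (RungStep n i j ⊎ RungStep n j i)

data Walk (n : ℕ) : Fin (n + n) → Fin (n + n) → ℕ → Set where
  here  : ∀ {u} → Walk n u u 0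
  there : ∀ {u w v k} → Adj n u w → Walk n w v k → Walk n u v (suc k)

Dist : (n : ℕ) → Fin (n + n) → Fin (n + n) → ℕ → Set
Dist n u v k = Walk n u v k × (∀ m → m < k → ¬ Walk n u v m)

Covers : (n : ℕ) → Fin (n + n) → ℕ → Fin (n + n) → Set
Covers n x ℓ v = Dist n x v ℓ

-- Rotation i ↦ i + 1 is an automorphism of M_{2n}, so we may take x = x₁. The distance from x₁
-- to the vertex at rim offset b is depth b = min(c, n + 1 − c) with c = min(b, 2n − b): explicit
-- walks attain it, and it changes by at most one along every edge. For s < n the vertices
-- x_{s+2} and x_{n+s+1} have equal depth and are joined by the path x_{s+2} x_{s+1} x_{n+s+1};
-- they are no closer, since rotating by n − s carries them to x_{n+2} and x₁, and
-- depth (n + 1) = 2 once n ≥ 3. Every vertex other than x₁ belongs to such a pair.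
module Submission where

open import Defs
open import Data.Nat using (ℕ; zero; suc; _+_; _∸_; _≤_; _<_; _⊓_; z≤n; s≤s; ⌈_/2⌉; _<?_; _≤?_)
open import Data.Nat.Properties
open import Data.Fin using (Fin; toℕ; fromℕ<)
open import Data.Fin.Properties using (toℕ<n; toℕ-fromℕ<; toℕ-injective)
open import Data.Product using (Σ; _×_; _,_; proj₂)
open import Data.Sum using (_⊎_; inj₁; inj₂)
open import Data.Empty using (⊥-elim)
open import Relation.Nullary using (yes; no)
open import Relation.Binary.PropositionalEquality

Near : ℕ → ℕ → Set
Near a b = a ≤ suc b × b ≤ suc a

Near-sym : ∀ {a b} → Near a b → Near b a
Near-sym (p , q) = q , p

Near-suc : ∀ a → Near a (suc a)
Near-suc a = m≤n⇒m≤1+n (n≤1+n a) , ≤-refl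

Near-⊓ : ∀ {a a′ b b′} → Near a a′ → Near b b′ → Near (a ⊓ b) (a′ ⊓ b′)
Near-⊓ (p , q) (r , s) = ⊓-mono-≤ p r , ⊓-mono-≤ q s

m∸n≤1+[m∸1+n] : ∀ m n → m ∸ n ≤ suc (m ∸ suc n)
m∸n≤1+[m∸1+n] zero    zero    = z≤n
m∸n≤1+[m∸1+n] zero    (suc n) = z≤n
m∸n≤1+[m∸1+n] (suc m) zero    = ≤-refl
m∸n≤1+[m∸1+n] (suc m) (suc n) = m∸n≤1+[m∸1+n] m n

m+n+[m∸n]≡m+m : ∀ {m n} → n ≤ m → m + n + (m ∸ n) ≡ m + m
m+n+[m∸n]≡m+m {m} {n} n≤m = trans (+-assoc m n (m ∸ n)) (cong (m +_) (m+[n∸m]≡n n≤m))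

Near-∸ : ∀ m {a a′} → Near a a′ → Near (m ∸ a) (m ∸ a′)
Near-∸ m {a} {a′} (p , q) =
  ≤-trans (m∸n≤1+[m∸1+n] m a) (s≤s (∸-monoʳ-≤ m q)) ,
  ≤-trans (m∸n≤1+[m∸1+n] m a′) (s≤s (∸-monoʳ-≤ m p))

0<m+m⇒1<m+m : ∀ {m} → 0 < m + m → 1 < m + m
0<m+m⇒1<m+m {suc m} _ = s≤s (≤-trans (s≤s z≤n) (m≤n+m (suc m) m))

module _ {n : ℕ} where

  Adj-sym : ∀ {u v} → Adj n u v → Adj n v u
  Adj-sym (inj₁ (inj₁ r)) = inj₁ (inj₂ r)
  Adj-sym (inj₁ (inj₂ r)) = inj₁ (inj₁ r)
  Adj-sym (inj₂ (inj₁ r)) = inj₂ (inj₂ r)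
  Adj-sym (inj₂ (inj₂ r)) = inj₂ (inj₁ r)

  Walk-snoc : ∀ {u v w k} → Walk n u v k → Adj n v w → Walk n u w (suc k)
  Walk-snoc here        a = there a here
  Walk-snoc (there b p) a = there b (Walk-snoc p a)

  Walk-reverse : ∀ {u v k} → Walk n u v k → Walk n v u k
  Walk-reverse here        = here
  Walk-reverse (there a p) = Walk-snoc (Walk-reverse p) (Adj-sym a)

  Walk-⊓ : ∀ {u v p q} → Walk n u v p → Walk n u v q → Walk n u v (p ⊓ q)
  Walk-⊓ {u} {v} {p} {q} w w′ with ⊓-sel p q
  ... | inj₁ e = subst (Walk n u v) (sym e) w
  ... | inj₂ e = subst (Walk n u v) (sym e) w′

  Dist-intro : ∀ {u v k} → Walk n u v k → (∀ {m} → Walk n u v m → k ≤ m) → Dist n u v k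
  Dist-intro w shortest = w , λ m m<k w′ → <⇒≱ m<k (shortest w′)

  Dist-sym : ∀ {u v k} → Dist n u v k → Dist n v u k
  Dist-sym (w , shortest) = Walk-reverse w , λ m m<k w′ → shortest m m<k (Walk-reverse w′)

  Dist-unique : ∀ {u v k k′} → Dist n u v k → Dist n u v k′ → k ≡ k′
  Dist-unique (w , shortest) (w′ , shortest′) =
    ≤-antisym (≮⇒≥ λ k′<k → shortest _ k′<k w′) (≮⇒≥ λ k<k′ → shortest′ _ k<k′ w)

module Ladder (n : ℕ) where

  N : ℕ
  N = n + n

  V : Set
  V = Fin N

  rotate : V → V
  rotate i with suc (toℕ i) <? N
  ... | yes i+1<N = fromℕ< i+1<N
  ... | no  _     = fromℕ< {0} (≤-<-trans z≤n (toℕ<n i))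

  toℕ-rotate : ∀ i → (suc (toℕ i) < N × toℕ (rotate i) ≡ suc (toℕ i))
                   ⊎ (suc (toℕ i) ≡ N × toℕ (rotate i) ≡ 0)
  toℕ-rotate i with suc (toℕ i) <? N
  ... | yes i+1<N = inj₁ (i+1<N , toℕ-fromℕ< i+1<N)
  ... | no  i+1≮N = inj₂ (≤-antisym (toℕ<n i) (≮⇒≥ i+1≮N) , toℕ-fromℕ< _)

  toℕ-rotate-< : ∀ i → suc (toℕ i) < N → toℕ (rotate i) ≡ suc (toℕ i)
  toℕ-rotate-< i lt with toℕ-rotate i
  ... | inj₁ (_ , e) = e
  ... | inj₂ (e , _) = ⊥-elim (<-irrefl e lt)

  toℕ-rotate-≡ : ∀ i → suc (toℕ i) ≡ N → toℕ (rotate i) ≡ 0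
  toℕ-rotate-≡ i eq with toℕ-rotate i
  ... | inj₁ (lt , _) = ⊥-elim (<-irrefl eq lt)
  ... | inj₂ (_ , e) = e

  Adj-rotate : ∀ i → Adj n i (rotate i)
  Adj-rotate i with toℕ-rotate i
  ... | inj₁ (_ , e)  = inj₁ (inj₁ (inj₁ e))
  ... | inj₂ (eq , e) = inj₁ (inj₁ (inj₂ (eq , e)))

  RimStep-rotate : ∀ {u w} → RimStep n u w → RimStep n (rotate u) (rotate w)
  RimStep-rotate {u} {w} (inj₁ w≡u+1) with toℕ-rotate w
  ... | inj₁ (_ , e)  = inj₁ (trans e (cong suc (trans w≡u+1 (sym (toℕ-rotate-< u u+1<N)))))
    where u+1<N = subst (_< N) w≡u+1 (toℕ<n w)
  ... | inj₂ (eq , e) = inj₂ (trans (cong suc (trans (toℕ-rotate-< u u+1<N) (sym w≡u+1))) eq , e)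
    where u+1<N = subst (_< N) w≡u+1 (toℕ<n w)
  RimStep-rotate {u} {w} (inj₂ (u+1≡N , w≡0)) =
    inj₁ (trans (toℕ-rotate-< w 1<N) (cong suc (trans w≡0 (sym (toℕ-rotate-≡ u u+1≡N)))))
    where
    1<N : suc (toℕ w) < N
    1<N = subst (λ m → suc m < N) (sym w≡0) (0<m+m⇒1<m+m {n} (≤-<-trans z≤n (toℕ<n w)))

  RungStep-rotate : ∀ {u w} → RungStep n u w →
                    RungStep n (rotate u) (rotate w) ⊎ RungStep n (rotate w) (rotate u)
  RungStep-rotate {u} {w} w≡u+n with toℕ-rotate w
  ... | inj₁ (_ , e)  = inj₁ (trans e (trans (cong suc w≡u+n) (cong (_+ n) (sym u↦u+1))))
    where
    u<n   = +-cancelʳ-< n (toℕ u) n (subst (_< N) w≡u+n (toℕ<n w))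
    u↦u+1 = toℕ-rotate-< u (≤-<-trans u<n (m<m+n n (≤-<-trans z≤n u<n)))
  ... | inj₂ (eq , e) = inj₂ (trans u↦u+1 (trans u+1≡n (cong (_+ n) (sym e))))
    where
    u<n   = +-cancelʳ-< n (toℕ u) n (subst (_< N) w≡u+n (toℕ<n w))
    u↦u+1 = toℕ-rotate-< u (≤-<-trans u<n (m<m+n n (≤-<-trans z≤n u<n)))
    u+1≡n = +-cancelʳ-≡ n (suc (toℕ u)) n (trans (cong suc (sym w≡u+n)) eq)

  Adj-rotate-rotate : ∀ {u w} → Adj n u w → Adj n (rotate u) (rotate w)
  Adj-rotate-rotate (inj₁ (inj₁ r)) = inj₁ (inj₁ (RimStep-rotate r))
  Adj-rotate-rotate (inj₁ (inj₂ r)) = inj₁ (inj₂ (RimStep-rotate r))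
  Adj-rotate-rotate (inj₂ (inj₁ r)) with RungStep-rotate r
  ... | inj₁ s = inj₂ (inj₁ s)
  ... | inj₂ s = inj₂ (inj₂ s)
  Adj-rotate-rotate (inj₂ (inj₂ r)) with RungStep-rotate r
  ... | inj₁ s = inj₂ (inj₂ s)
  ... | inj₂ s = inj₂ (inj₁ s)

  rotateBy : ℕ → V → V
  rotateBy zero    i = i
  rotateBy (suc k) i = rotateBy k (rotate i)

  Walk-rotateBy : ∀ k {u v m} → Walk n u v m → Walk n (rotateBy k u) (rotateBy k v) m
  Walk-rotateBy zero    p = p
  Walk-rotateBy (suc k) p = Walk-rotateBy k (rotateWalk p)
    where
    rotateWalk : ∀ {u v m} → Walk n u v m → Walk n (rotate u) (rotate v) m
    rotateWalk here        = here
    rotateWalk (there a p) = there (Adj-rotate-rotate a) (rotateWalk p)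

  rotateBy-+ : ∀ j k i → rotateBy (j + k) i ≡ rotateBy k (rotateBy j i)
  rotateBy-+ zero    k i = refl
  rotateBy-+ (suc j) k i = rotateBy-+ j k (rotate i)

  toℕ-rotateBy-< : ∀ k i → toℕ i + k < N → toℕ (rotateBy k i) ≡ toℕ i + k
  toℕ-rotateBy-< zero    i _  = sym (+-identityʳ _)
  toℕ-rotateBy-< (suc k) i lt = begin
    toℕ (rotateBy k (rotate i)) ≡⟨ toℕ-rotateBy-< k _ (subst (_< N) (sym shift) lt) ⟩
    toℕ (rotate i) + k          ≡⟨ shift ⟩
    toℕ i + suc k               ∎
    where
    open ≡-Reasoning
    i+1<N  = ≤-<-trans (m<m+n (toℕ i) (s≤s z≤n)) lt
    shift : toℕ (rotate i) + k ≡ toℕ i + suc k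
    shift = trans (cong (_+ k) (toℕ-rotate-< i i+1<N)) (sym (+-suc (toℕ i) k))

  toℕ-rotateBy-≡ : ∀ k i → toℕ i + k ≡ N → toℕ (rotateBy k i) ≡ 0
  toℕ-rotateBy-≡ zero          i eq = ⊥-elim (<-irrefl (trans (sym (+-identityʳ _)) eq) (toℕ<n i))
  toℕ-rotateBy-≡ (suc zero)    i eq = toℕ-rotate-≡ i (trans (+-comm 1 (toℕ i)) eq)
  toℕ-rotateBy-≡ (suc (suc k)) i eq = toℕ-rotateBy-≡ (suc k) (rotate i) shift
    where
    i+2+k≡N = trans (sym (+-suc (toℕ i) (suc k))) eq
    i+1<N   = subst (suc (toℕ i) <_) i+2+k≡N (s≤s (m<m+n (toℕ i) (s≤s z≤n)))
    shift   = trans (cong (_+ suc k) (toℕ-rotate-< i i+1<N)) i+2+k≡N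

  rotateBy-N : ∀ i → rotateBy N i ≡ i
  rotateBy-N i = toℕ-injective (begin
    toℕ (rotateBy N i)                ≡⟨ cong (λ m → toℕ (rotateBy m i)) (sym (m∸n+n≡m i≤N)) ⟩
    toℕ (rotateBy (j + a) i)          ≡⟨ cong toℕ (rotateBy-+ j a i) ⟩
    toℕ (rotateBy a (rotateBy j i))   ≡⟨ toℕ-rotateBy-< a _ (subst (λ m → m + a < N) (sym at0) (toℕ<n i)) ⟩
    toℕ (rotateBy j i) + a            ≡⟨ cong (_+ a) at0 ⟩
    a                                 ∎)
    where
    open ≡-Reasoning
    a   = toℕ i
    i≤N = <⇒≤ (toℕ<n i)
    j   = N ∸ a
    at0 = toℕ-rotateBy-≡ j i (m+[n∸m]≡n i≤N)

  rotateBy-inverse : ∀ j k → j + k ≡ N → ∀ i → rotateBy k (rotateBy j i) ≡ i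
  rotateBy-inverse j k eq i =
    trans (sym (rotateBy-+ j k i)) (trans (cong (λ m → rotateBy m i) eq) (rotateBy-N i))

  Dist-rotateBy : ∀ j k → j + k ≡ N → ∀ {u v ℓ} → Dist n u v ℓ →
                  Dist n (rotateBy j u) (rotateBy j v) ℓ
  Dist-rotateBy j k eq {u} {v} (p , shortest) = Walk-rotateBy j p , λ m m<ℓ q →
    shortest m m<ℓ (subst₂ (λ a b → Walk n a b m)
      (rotateBy-inverse j k eq u) (rotateBy-inverse j k eq v) (Walk-rotateBy k q))

  Walk-rotateBy-self : ∀ k i → Walk n i (rotateBy k i) k
  Walk-rotateBy-self zero    i = here
  Walk-rotateBy-self (suc k) i = there (Adj-rotate i) (Walk-rotateBy-self k (rotate i))

  Walk-along : ∀ k {i j} → toℕ i + k ≡ toℕ j → Walk n i j k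
  Walk-along k {i} {j} eq =
    subst (λ j′ → Walk n i j′ k) (toℕ-injective lands) (Walk-rotateBy-self k i)
    where lands = trans (toℕ-rotateBy-< k i (subst (_< N) (sym eq) (toℕ<n j))) eq

  Walk-along-wrap : ∀ k {i j} → toℕ i + k ≡ N → toℕ j ≡ 0 → Walk n i j k
  Walk-along-wrap k {i} {j} eq j≡0 =
    subst (λ j′ → Walk n i j′ k) (toℕ-injective lands) (Walk-rotateBy-self k i)
    where lands = trans (toℕ-rotateBy-≡ k i eq) (sym j≡0)

  low-or-high : ∀ (v : V) → toℕ v ≤ n ⊎ Σ ℕ (λ t → t < n × toℕ v ≡ n + t)
  low-or-high v with toℕ v ≤? n
  ... | yes v≤n = inj₁ v≤n
  ... | no  v≰n = inj₂ (toℕ v ∸ n , +-cancelˡ-< n _ n (subst (_< N) v≡n+t (toℕ<n v)) , v≡n+t)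
    where v≡n+t = sym (m+[n∸m]≡n (<⇒≤ (≰⇒> v≰n)))

  -- A shortest walk from x₁ to the vertex at rim offset b either stays on the rim
  -- (c = min(b, 2n − b) steps) or takes one rung and then n − c rim steps.
  cycleDist : ℕ → ℕ
  cycleDist b = b ⊓ (N ∸ b)

  shortcut : ℕ → ℕ
  shortcut c = c ⊓ (suc n ∸ c)

  depth : ℕ → ℕ
  depth b = shortcut (cycleDist b)

  depth-low : ∀ {b} → b ≤ n → depth b ≡ b ⊓ suc (n ∸ b)
  depth-low {b} b≤n = trans (cong shortcut cycleDist-low) (cong (b ⊓_) (+-∸-assoc 1 b≤n))
    where
    cycleDist-low : cycleDist b ≡ b
    cycleDist-low =
      m≤n⇒m⊓n≡m (≤-trans b≤n (subst (_≤ N ∸ b) (m+n∸n≡m n n) (∸-monoʳ-≤ N b≤n)))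

  depth-high : ∀ {t} → t ≤ n → depth (n + t) ≡ (n ∸ t) ⊓ suc t
  depth-high {t} t≤n = trans (cong shortcut cycleDist-high)
    (cong ((n ∸ t) ⊓_) (trans (+-∸-assoc 1 (m∸n≤m n t)) (cong suc (m∸[m∸n]≡n t≤n))))
    where
    cycleDist-high : cycleDist (n + t) ≡ n ∸ t
    cycleDist-high = trans (cong ((n + t) ⊓_) ([m+n]∸[m+o]≡n∸o n n t))
                           (m≥n⇒m⊓n≡n (≤-trans (m∸n≤m n t) (m≤m+n n t)))

  Near-depth-RimStep : ∀ {u w} → RimStep n u w → Near (depth (toℕ u)) (depth (toℕ w))
  Near-depth-RimStep {u} (inj₁ w≡u+1) rewrite w≡u+1 = Near-⊓ near (Near-∸ (suc n) near)
    where near = Near-⊓ (Near-suc (toℕ u)) (Near-∸ N (Near-suc (toℕ u)))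
  Near-depth-RimStep {u} (inj₂ (u+1≡N , w≡0)) rewrite w≡0 =
    ≤-trans (m⊓n≤m _ _) (≤-trans (m⊓n≤n _ _) (≤-reflexive N∸u≡1)) , z≤n
    where N∸u≡1 = trans (cong (_∸ toℕ u) (sym u+1≡N)) (m+n∸n≡m 1 (toℕ u))

  Near-depth-RungStep : ∀ {u w} → RungStep n u w → Near (depth (toℕ u)) (depth (toℕ w))
  Near-depth-RungStep {u} {w} w≡u+n =
    subst₂ Near (sym (depth-low b≤n)) (sym (trans (cong depth w≡n+b) (depth-high b≤n)))
      (subst (Near (b ⊓ suc (n ∸ b))) (⊓-comm (suc b) (n ∸ b))
        (Near-⊓ (Near-suc b) (Near-sym (Near-suc (n ∸ b)))))
    where
    b = toℕ u
    w≡n+b = trans w≡u+n (+-comm b n)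
    b≤n = <⇒≤ (+-cancelʳ-< n b n (subst (_< N) w≡u+n (toℕ<n w)))

  Near-depth-Adj : ∀ {u w} → Adj n u w → Near (depth (toℕ u)) (depth (toℕ w))
  Near-depth-Adj (inj₁ (inj₁ r)) = Near-depth-RimStep r
  Near-depth-Adj (inj₁ (inj₂ r)) = Near-sym (Near-depth-RimStep r)
  Near-depth-Adj (inj₂ (inj₁ r)) = Near-depth-RungStep r
  Near-depth-Adj (inj₂ (inj₂ r)) = Near-sym (Near-depth-RungStep r)

  depth-Walk : ∀ {u v m} → Walk n u v m → depth (toℕ v) ≤ depth (toℕ u) + m
  depth-Walk here = m≤m+n _ 0
  depth-Walk {u} {v} {suc m} (there a p) = begin
    depth (toℕ v)           ≤⟨ depth-Walk p ⟩
    depth (toℕ _) + m       ≤⟨ +-monoˡ-≤ m (proj₂ (Near-depth-Adj a)) ⟩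
    suc (depth (toℕ u)) + m ≡⟨ sym (+-suc _ m) ⟩
    depth (toℕ u) + suc m   ∎
    where open ≤-Reasoning

  Walk-viaRung : 1 ≤ n → ∀ {z v k} → toℕ z ≡ 0 →
                 (∀ {m} → toℕ m ≡ n → Walk n m v k) → Walk n z v (suc k)
  Walk-viaRung 1≤n z≡0 fromOpposite =
    there (inj₂ (inj₁ (trans opposite≡n (cong (_+ n) (sym z≡0))))) (fromOpposite opposite≡n)
    where opposite≡n = toℕ-fromℕ< (m<m+n n 1≤n)

  Walk-fromZero : 1 ≤ n → ∀ {z} → toℕ z ≡ 0 → ∀ v → Walk n z v (depth (toℕ v))
  Walk-fromZero 1≤n {z} z≡0 v with low-or-high v
  ... | inj₁ v≤n = subst (Walk n z v) (sym (depth-low v≤n)) (Walk-⊓ alongRim viaRung)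
    where
    alongRim = Walk-along (toℕ v) (cong (_+ toℕ v) z≡0)
    viaRung  = Walk-viaRung 1≤n z≡0 λ m≡n →
      Walk-reverse (Walk-along (n ∸ toℕ v) (trans (m+[n∸m]≡n v≤n) (sym m≡n)))
  ... | inj₂ (t , t<n , v≡n+t) =
    subst (Walk n z v) (sym (trans (cong depth v≡n+t) (depth-high (<⇒≤ t<n))))
      (Walk-⊓ aroundWrap viaRung)
    where
    v+[n∸t]≡N  = trans (cong (_+ (n ∸ t)) v≡n+t) (m+n+[m∸n]≡m+m (<⇒≤ t<n))
    aroundWrap = Walk-reverse (Walk-along-wrap (n ∸ t) v+[n∸t]≡N z≡0)
    viaRung    = Walk-viaRung 1≤n z≡0 λ m≡n → Walk-along t (trans (cong (_+ t) m≡n) (sym v≡n+t))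

  Dist-fromZero : 1 ≤ n → ∀ {z} → toℕ z ≡ 0 → ∀ v → Dist n z v (depth (toℕ v))
  Dist-fromZero 1≤n z≡0 v = Dist-intro (Walk-fromZero 1≤n z≡0 v) λ {m} p →
    subst (λ c → depth (toℕ v) ≤ depth c + m) z≡0 (depth-Walk p)

  depth-partner : ∀ {s} → s < n → depth (suc s) ≡ depth (n + s)
  depth-partner {s} s<n = begin
    depth (suc s)           ≡⟨ depth-low s<n ⟩
    suc s ⊓ suc (n ∸ suc s) ≡⟨ cong (suc s ⊓_) (sym (+-∸-assoc 1 s<n)) ⟩
    suc s ⊓ (n ∸ s)         ≡⟨ ⊓-comm (suc s) (n ∸ s) ⟩
    (n ∸ s) ⊓ suc s         ≡⟨ sym (depth-high (<⇒≤ s<n)) ⟩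
    depth (n + s)           ∎
    where open ≡-Reasoning

  depth-n+1 : 3 ≤ n → depth (n + 1) ≡ 2
  depth-n+1 3≤n = trans (depth-high (≤-trans (s≤s z≤n) 3≤n)) (m≥n⇒m⊓n≡n (∸-monoˡ-≤ 1 3≤n))

  Dist-partner : 3 ≤ n → ∀ {s u v} → s < n → toℕ u ≡ suc s → toℕ v ≡ n + s → Dist n u v 2
  Dist-partner 3≤n {s} {u} {v} s<n u≡s+1 v≡n+s = Dist-intro viaPredecessor shortest
    where
    s<N = <-≤-trans s<n (m≤m+n n n)
    w≡s = toℕ-fromℕ< s<N
    viaPredecessor : Walk n u v 2
    viaPredecessor =
      there (inj₁ (inj₂ (inj₁ (trans u≡s+1 (cong suc (sym w≡s))))))
      (there (inj₂ (inj₁ (trans v≡n+s (trans (+-comm n s) (cong (_+ n) (sym w≡s)))))) here)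
    k = n ∸ s
    v+k≡N : toℕ v + k ≡ N
    v+k≡N = trans (cong (_+ k) v≡n+s) (m+n+[m∸n]≡m+m (<⇒≤ s<n))
    u+k≡n+1 : toℕ u + k ≡ n + 1
    u+k≡n+1 = trans (cong (_+ k) u≡s+1) (trans (cong suc (m+[n∸m]≡n (<⇒≤ s<n))) (+-comm 1 n))
    n+1<N : n + 1 < N
    n+1<N = +-monoʳ-< n (≤-trans (s≤s (s≤s z≤n)) 3≤n)
    shortest : ∀ {m} → Walk n u v m → 2 ≤ m
    shortest {m} p = begin
      2                                  ≡⟨ sym (depth-n+1 3≤n) ⟩
      depth (n + 1)                      ≡⟨ cong depth (sym u′≡n+1) ⟩
      depth (toℕ (rotateBy k u))         ≤⟨ depth-Walk (Walk-reverse (Walk-rotateBy k p)) ⟩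
      depth (toℕ (rotateBy k v)) + m     ≡⟨ cong (λ c → depth c + m) (toℕ-rotateBy-≡ k v v+k≡N) ⟩
      m                                  ∎
      where
      open ≤-Reasoning
      u′≡n+1 = trans (toℕ-rotateBy-< k u (subst (_< N) (sym u+k≡n+1) n+1<N)) u+k≡n+1

  equidistantPartner : 3 ≤ n → ∀ v → 1 ≤ depth (toℕ v) →
                       Σ V (λ u → depth (toℕ u) ≡ depth (toℕ v) × Dist n u v 2)
  equidistantPartner 3≤n v 1≤depth with low-or-high v
  ... | inj₂ (t , t<n , v≡n+t) =
    u , trans (cong depth u≡t+1) (trans (depth-partner t<n) (cong depth (sym v≡n+t))) ,
    Dist-partner 3≤n t<n u≡t+1 v≡n+t
    where
    t+1<N = ≤-<-trans t<n (m<m+n n (≤-trans (s≤s z≤n) 3≤n))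
    u = fromℕ< t+1<N
    u≡t+1 = toℕ-fromℕ< t+1<N
  ... | inj₁ v≤n with toℕ v in v≡s+1
  ...   | zero  = ⊥-elim (<-irrefl refl 1≤depth)
  ...   | suc s =
    u , trans (cong depth u≡n+s) (sym (depth-partner s<n)) ,
    Dist-sym (Dist-partner 3≤n s<n v≡s+1 u≡n+s)
    where
    s<n = v≤n
    n+s<N = +-monoʳ-< n s<n
    u = fromℕ< n+s<N
    u≡n+s = toℕ-fromℕ< n+s<N

  coverPartner-fromZero : 3 ≤ n → ∀ {z v ℓ} → toℕ z ≡ 0 → 1 ≤ ℓ → Dist n z v ℓ →
                          Σ V (λ u → Dist n z u ℓ × Dist n u v 2)
  coverPartner-fromZero 3≤n {z} {v} z≡0 1≤ℓ z-v =
    let u , depth-u≡depth-v , u-v = equidistantPartner 3≤n v (subst (1 ≤_) ℓ≡depth 1≤ℓ)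
    in u , subst (Dist n z u) (trans depth-u≡depth-v (sym ℓ≡depth)) (Dist-fromZero 1≤n z≡0 u) ,
       u-v
    where
    1≤n = ≤-trans (s≤s z≤n) 3≤n
    ℓ≡depth = Dist-unique z-v (Dist-fromZero 1≤n z≡0 v)

lemma3p5 : (n : ℕ) → 3 ≤ n → (x : Fin (n + n)) → (ℓ : ℕ) → 1 ≤ ℓ → ℓ ≤ ⌈ n /2⌉ →
    (v : Fin (n + n)) → Covers n x ℓ v →
    Σ (Fin (n + n)) (λ u → Covers n x ℓ u × Dist n u v 2)
lemma3p5 n 3≤n x ℓ 1≤ℓ _ v x-v =
  let u , x′-u , u-v′ = coverPartner-fromZero 3≤n x′≡0 1≤ℓ (Dist-rotateBy k a k+a≡N x-v)
  in rotateBy a u ,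
     subst (λ y → Dist n y (rotateBy a u) ℓ) (back x) (Dist-rotateBy a k a+k≡N x′-u) ,
     subst (λ y → Dist n (rotateBy a u) y 2) (back v) (Dist-rotateBy a k a+k≡N u-v′)
  where
  open Ladder n
  a = toℕ x
  k = N ∸ a
  a+k≡N = m+[n∸m]≡n (<⇒≤ (toℕ<n x))
  k+a≡N = m∸n+n≡m (<⇒≤ (toℕ<n x))
  x′≡0 = toℕ-rotateBy-≡ k x a+k≡N
  back = rotateBy-inverse k a k+a≡N
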